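{- For any integer $b\geq 1$, \begin{align*} X_{T^{\langle 4,b \rangle}_{v_4}}=&\,20 X_{P_{b+5}}+2 e_1 X_{P_{b+4}}-16 e_2 X_{P_{b+3}}-(2 e_{(2,1)} +42 e_3 ) X_{P_{b+2}} \\ &-(56e_4+4e_{(2,2)}+4e_{(3,1)}) X_{P_{b+1}} -(6e_{(4,1)}+4e_{(3,2)}+50e_5 ) X_{P_{b}}. \end{align*}
   Context: For a finite simple graph $G$ with vertex set $\{v_1,\dots,v_d\}$, the chromatic symmetric function is $X_G=\sum_{\kappa} x_{\kappa(v_1)}\cdots x_{\kappa(v_d)}$, summed over all proper colorings $\kappa:V(G)\to\{1,2,\dots\}$, with commuting indeterminates $x_1,x_2,\dots$. $e_k$ denotes the elementary symmetric function of degree $k$ and $e_\lambda=e_{\lambda_1}e_{\lambda_2}\cdots$. $P_n$ denotes the path on $n$ vertices. For $a\ge3$, $b\ge1$, the tadpole graph $T^{\langle a,b\rangle}$ has vertices $v_1,\dots,v_{a+b}$ and consists of the cycle $v_1v_2\cdots v_av_1$, the path $v_{a+1}\cdots v_{a+b}$, and the edge $v_av_{a+1}$; thus $v_4$ is the unique vertex of degree $3$ in $T^{\langle 4,b\rangle}$. For a graph $G$ and vertex $v$, the twin graph $G_v$ is obtained by adding a new vertex $v'$ adjacent to $v$ and to exactly the neighbors of $v$ in $G$. -}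

module Defs where

open import Data.Nat as ℕ using (ℕ; zero; suc; _≡ᵇ_; _<ᵇ_; _∸_)
open import Data.Integer as ℤ using (ℤ; +_; _+_; _*_; _-_)
open import Data.Fin as Fin using (Fin; zero; suc; toℕ)
open import Data.Bool using (Bool; true; false; _∧_; _∨_; if_then_else_; not)
open import Data.List as List using (List; []; _∷_; concatMap; map; allFin)
open import Data.Vec as Vec using (Vec; []; _∷_; lookup)
open import Relation.Nullary.Decidable using (⌊_⌋)

-- A finite simple graph on vertex set Fin order, given by a Bool-valued
-- adjacency relation (all graphs built below are symmetric and loopless).
record Graph : Set where
  field
    order : ℕ
    adj   : Fin order → Fin order → Bool
open Graph public

sumℤ : List ℤ → ℤ
sumℤ = List.foldr _+_ (+ 0)

prodFin : (d : ℕ) → (Fin d → ℤ) → ℤ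
prodFin zero    f = + 1
prodFin (suc d) f = f zero * prodFin d (λ i → f (suc i))

allVecs : {A : Set} → List A → (d : ℕ) → List (Vec A d)
allVecs xs zero    = [] ∷ []
allVecs xs (suc d) = concatMap (λ a → map (a ∷_) (allVecs xs d)) xs

andFin : (d : ℕ) → (Fin d → Bool) → Bool
andFin zero    f = true
andFin (suc d) f = f zero ∧ andFin d (λ i → f (suc i))

proper : (G : Graph) {N : ℕ} → (Fin (order G) → Fin N) → Bool
proper G κ = andFin (order G) (λ u → andFin (order G) (λ w →
               not (adj G u w) ∨ not ⌊ κ u Fin.≟ κ w ⌋))

-- Chromatic symmetric function X_G specialised to the variables
-- x_1,…,x_N (x_i = 0 for i > N), evaluated at x : Fin N → ℤ:
-- sum over proper colourings κ : V(G) → {1..N} of ∏_v x_{κ(v)}.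
X : Graph → (N : ℕ) → (Fin N → ℤ) → ℤ
X G N x = sumℤ (map term (allVecs (allFin N) (order G)))
  where
  term : Vec (Fin N) (order G) → ℤ
  term κ = if proper G (lookup κ) then prodFin (order G) (λ v → x (lookup κ v)) else + 0

count : {N : ℕ} → Vec Bool N → ℕ
count []          = 0
count (true ∷ s)  = suc (count s)
count (false ∷ s) = count s

e : ℕ → (N : ℕ) → (Fin N → ℤ) → ℤ
e k N x = sumℤ (map term (allVecs (true ∷ false ∷ []) N))
  where
  term : Vec Bool N → ℤ
  term S = if count S ≡ᵇ k
           then prodFin N (λ i → if lookup S i then x i else + 1)
           else + 0

-- path P_n on vertices 0,…,n-1 (v_{i+1} ↔ index i)
path : ℕ → Graph
path n = record { order = n ; adj = λ i j → (suc (toℕ i) ≡ᵇ toℕ j) ∨ (suc (toℕ j) ≡ᵇ toℕ i) }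

-- tadpole T^{⟨a,b⟩}: vertex v_{i+1} ↔ index i.
-- cycle v_1…v_a v_1, path v_{a+1}…v_{a+b}, edge v_a v_{a+1}.
tadpoleEdge : ℕ → ℕ → ℕ → ℕ → Bool
tadpoleEdge a b i j =
     ((i <ᵇ a) ∧ (j <ᵇ a) ∧ (suc i ≡ᵇ j))
  ∨ ((i ≡ᵇ 0) ∧ (j ≡ᵇ (a ∸ 1)))
  ∨ ((i ≡ᵇ (a ∸ 1)) ∧ (j ≡ᵇ a))
  ∨ ((ℕ._≤ᵇ_ a i) ∧ (j <ᵇ (a ℕ.+ b)) ∧ (suc i ≡ᵇ j))

tadpole : (a b : ℕ) → Graph
tadpole a b = record
  { order = a ℕ.+ b
  ; adj   = λ u w → tadpoleEdge a b (toℕ u) (toℕ w) ∨ tadpoleEdge a b (toℕ w) (toℕ u) }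

-- twin graph G_v: the new vertex v' is index zero, old vertex u is suc u;
-- v' is adjacent to v and to exactly the neighbours of v.
twin : (G : Graph) → Fin (order G) → Graph
twin G v = record { order = suc (order G) ; adj = A }
  where
  A : Fin (suc (order G)) → Fin (suc (order G)) → Bool
  A zero    zero    = false
  A zero    (suc w) = ⌊ w Fin.≟ v ⌋ ∨ adj G v w
  A (suc u) zero    = ⌊ u Fin.≟ v ⌋ ∨ adj G v u
  A (suc u) (suc w) = adj G u w

v₄ : (b : ℕ) → Fin (order (tadpole 4 b))
v₄ b = suc (suc (suc zero))

-- The twin graph G = T^{⟨4,b⟩}_{v₄} is its head on v₁, …, v₄, v₄′, v₅ glued at v₅ to the path v₅ …
-- v_{b+4}, and likewise P_{b+q} is its first q + 1 vertices glued to a path on b vertices. Summing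
-- over the colour c of the glue vertex, X = ∑_c H(c) · x_c · R(c), where R(c) comes from the common
-- path on b vertices and H(c) is the sum over colourings of the head whose root has colour c. It
-- therefore suffices to show H_G(c) = ∑_q κ_q H_{P_q}(c) for each c, with κ_q the claimed
-- coefficient of X_{P_{b+q}}. Each rooted head sum is computed symbolically: inclusion–exclusion
-- over the head's edges turns properness into a signed sum of equality constraints, and summing out
-- constrained vertices one at a time leaves a polynomial in x_c and the power sums p₁, …, p₅.
-- Writing p_j in terms of e₁, …, e₅ (Girard–Waring) turns the claim into a polynomial identity in
-- x_c, e₁, …, e₅, which holds because both sides have the same normal form.
{-# OPTIONS --safe #-}
module Submission where

open import Defs
open import Data.Nat using (ℕ; zero; suc; _≤_; _+_; _≡ᵇ_; _<ᵇ_)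
import Data.Nat.Properties as ℕ
open import Data.Fin as Fin using (Fin; zero; suc; toℕ; _↑ˡ_; _↑ʳ_; #_)
open import Data.Fin.Patterns using (0F; 1F; 2F; 3F; 4F; 5F)
open import Data.Fin.Properties using (all?; toℕ<n)
open import Data.Integer using (ℤ; +_; _*_; -_; _^_) renaming (_+_ to _+ℤ_; _-_ to _-ℤ_)
import Data.Integer.Properties as ℤ
open import Data.Integer.Solver using (module +-*-Solver)
open +-*-Solver using (solve; prove; _:=_; _:+_; _:*_; _:-_; _:^_; :-_; con; var; Polynomial; ⟦_⟧)
open import Algebra.Properties.Semiring.Sum ℤ.+-*-semiring
  using (sum; sum-syntax; sum-cong-≗; sum-replicate-zero; ∑-distrib-+; ∑-comm; *-distribˡ-sum; *-distribʳ-sum)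
open import Algebra.Properties.CommutativeSemigroup ℤ.*-commutativeSemigroup using (x∙yz≈y∙xz)
open import Data.Bool as Bool using (Bool; true; false; if_then_else_; _∧_; _∨_; not; T)
open import Data.Bool.Properties using (T-∧; T-∨; T-≡; ⇔→≡; ∨-comm)
open import Data.Bool.ListAction using (any; all)
open import Data.Vec using (Vec; []; _∷_; lookup; _++_; updateAt; replicate)
open import Data.Vec.Properties using (lookup-++ˡ; lookup-++ʳ)
open import Data.Vec.N-ary using (N-ary)
open import Data.List as List using (List; []; _∷_; map; concatMap; allFin)
import Data.List.Properties as List
open import Data.Maybe using (Maybe; just; nothing)
open import Data.Product using (_×_; _,_; proj₁; proj₂)
open import Data.Product.Function.NonDependent.Propositional using (_×-⇔_)
open import Data.Sum as Sum using (_⊎_; inj₁; inj₂; [_,_]′)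
open import Data.Empty using (⊥-elim)
open import Function using (_∘_; _⇔_; mk⇔; Equivalence)
open import Function.Properties.Equivalence using () renaming (trans to ⇔-trans; sym to ⇔-sym)
open import Relation.Nullary using (Dec; yes; no; does)
open import Relation.Nullary.Decidable using (⌊_⌋; toWitness; fromWitness)
open import Relation.Binary.PropositionalEquality

sumℤ-++ : (xs ys : List ℤ) → sumℤ (xs List.++ ys) ≡ sumℤ xs +ℤ sumℤ ys
sumℤ-++ []       ys = sym (ℤ.+-identityˡ _)
sumℤ-++ (x ∷ xs) ys = trans (cong (x +ℤ_) (sumℤ-++ xs ys)) (sym (ℤ.+-assoc x _ _))

sumℤ-map-* : {A : Set} (k : ℤ) (f : A → ℤ) (xs : List A) → sumℤ (map (λ a → k * f a) xs) ≡ k * sumℤ (map f xs)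
sumℤ-map-* k f []       = sym (ℤ.*-zeroʳ k)
sumℤ-map-* k f (a ∷ xs) = trans (cong (k * f a +ℤ_) (sumℤ-map-* k f xs)) (sym (ℤ.*-distribˡ-+ k (f a) _))

sumℤ-concatMap : {A B : Set} (f : B → ℤ) (h : A → List B) (xs : List A) →
  sumℤ (map f (concatMap h xs)) ≡ sumℤ (map (λ a → sumℤ (map f (h a))) xs)
sumℤ-concatMap f h []       = refl
sumℤ-concatMap f h (a ∷ xs) = begin
  sumℤ (map f (h a List.++ concatMap h xs))           ≡⟨ cong sumℤ (List.map-++ f (h a) _) ⟩
  sumℤ (map f (h a) List.++ map f (concatMap h xs))   ≡⟨ sumℤ-++ (map f (h a)) _ ⟩
  sumℤ (map f (h a)) +ℤ sumℤ (map f (concatMap h xs)) ≡⟨ cong (sumℤ (map f (h a)) +ℤ_) (sumℤ-concatMap f h xs) ⟩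
  sumℤ (map f (h a)) +ℤ sumℤ (map (λ a → sumℤ (map f (h a))) xs) ∎
  where open ≡-Reasoning

sumℤ-allVecs-suc : {A : Set} (xs : List A) (d : ℕ) (f : Vec A (suc d) → ℤ) →
  sumℤ (map f (allVecs xs (suc d))) ≡ sumℤ (map (λ a → sumℤ (map (f ∘ (a ∷_)) (allVecs xs d))) xs)
sumℤ-allVecs-suc xs d f = trans (sumℤ-concatMap f _ xs)
  (cong sumℤ (List.map-cong (λ a → cong sumℤ (sym (List.map-∘ (allVecs xs d)))) xs))

sumℤ-tabulate : (N : ℕ) (f : Fin N → ℤ) → sumℤ (List.tabulate f) ≡ sum f
sumℤ-tabulate zero    f = refl
sumℤ-tabulate (suc N) f = cong (f zero +ℤ_) (sumℤ-tabulate N (f ∘ suc))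

sumℤ-allFin : (N : ℕ) (f : Fin N → ℤ) → sumℤ (map f (allFin N)) ≡ sum f
sumℤ-allFin N f = trans (cong sumℤ (List.map-tabulate (λ i → i) f)) (sumℤ-tabulate N f)

∑-linear : ∀ {n m} (k : Fin n → ℤ) (h : Fin n → Fin m → ℤ) (g : Fin m → ℤ) →
  ∑[ c < m ] (∑[ q < n ] (k q * h q c) * g c) ≡ ∑[ q < n ] (k q * ∑[ c < m ] (h q c * g c))
∑-linear {n} {m} k h g = begin
  ∑[ c < m ] (∑[ q < n ] (k q * h q c) * g c) ≡⟨ sum-cong-≗ {m} (λ c → *-distribʳ-sum (g c) (λ q → k q * h q c)) ⟩
  ∑[ c < m ] ∑[ q < n ] (k q * h q c * g c)   ≡⟨ ∑-comm (λ c q → k q * h q c * g c) ⟩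
  ∑[ q < n ] ∑[ c < m ] (k q * h q c * g c)   ≡⟨ sum-cong-≗ {n} (λ q → sum-cong-≗ {m} (λ c → ℤ.*-assoc (k q) (h q c) (g c))) ⟩
  ∑[ q < n ] ∑[ c < m ] (k q * (h q c * g c)) ≡⟨ sum-cong-≗ {n} (λ q → *-distribˡ-sum (k q) (λ c → h q c * g c)) ⟨
  ∑[ q < n ] (k q * ∑[ c < m ] (h q c * g c)) ∎
  where open ≡-Reasoning

module Colourings (N : ℕ) where

  ∑ᶜ : (d : ℕ) → (Vec (Fin N) d → ℤ) → ℤ
  ∑ᶜ zero    f = f []
  ∑ᶜ (suc d) f = ∑[ a < N ] ∑ᶜ d (f ∘ (a ∷_))

  ∑ᶜ-cong : ∀ d {f g : Vec (Fin N) d → ℤ} → (∀ κ → f κ ≡ g κ) → ∑ᶜ d f ≡ ∑ᶜ d g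
  ∑ᶜ-cong zero    f≗g = f≗g []
  ∑ᶜ-cong (suc d) f≗g = sum-cong-≗ {N} (λ a → ∑ᶜ-cong d (f≗g ∘ (a ∷_)))

  ∑ᶜ-distrib-+ : ∀ d (f g : Vec (Fin N) d → ℤ) → ∑ᶜ d (λ κ → f κ +ℤ g κ) ≡ ∑ᶜ d f +ℤ ∑ᶜ d g
  ∑ᶜ-distrib-+ zero    f g = refl
  ∑ᶜ-distrib-+ (suc d) f g =
    trans (sum-cong-≗ {N} (λ a → ∑ᶜ-distrib-+ d (f ∘ (a ∷_)) (g ∘ (a ∷_)))) (∑-distrib-+ {N} _ _)

  *-distribˡ-∑ᶜ : ∀ d k (f : Vec (Fin N) d → ℤ) → k * ∑ᶜ d f ≡ ∑ᶜ d (λ κ → k * f κ)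
  *-distribˡ-∑ᶜ zero    k f = refl
  *-distribˡ-∑ᶜ (suc d) k f =
    trans (*-distribˡ-sum {N} k _) (sum-cong-≗ {N} (λ a → *-distribˡ-∑ᶜ d k (f ∘ (a ∷_))))

  *-distribʳ-∑ᶜ : ∀ d k (f : Vec (Fin N) d → ℤ) → ∑ᶜ d f * k ≡ ∑ᶜ d (λ κ → f κ * k)
  *-distribʳ-∑ᶜ d k f = trans (ℤ.*-comm _ k)
    (trans (*-distribˡ-∑ᶜ d k f) (∑ᶜ-cong d (λ κ → ℤ.*-comm k (f κ))))

  ∑ᶜ-distrib-− : ∀ d (f g : Vec (Fin N) d → ℤ) → ∑ᶜ d (λ κ → f κ -ℤ g κ) ≡ ∑ᶜ d f -ℤ ∑ᶜ d g
  ∑ᶜ-distrib-− d f g = begin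
    ∑ᶜ d (λ κ → f κ +ℤ - g κ)          ≡⟨ ∑ᶜ-cong d (λ κ → cong (f κ +ℤ_) (ℤ.-1*i≡-i (g κ))) ⟨
    ∑ᶜ d (λ κ → f κ +ℤ - + 1 * g κ)    ≡⟨ ∑ᶜ-distrib-+ d f _ ⟩
    ∑ᶜ d f +ℤ ∑ᶜ d (λ κ → - + 1 * g κ) ≡⟨ cong (∑ᶜ d f +ℤ_) (*-distribˡ-∑ᶜ d (- + 1) g) ⟨
    ∑ᶜ d f +ℤ - + 1 * ∑ᶜ d g           ≡⟨ cong (∑ᶜ d f +ℤ_) (ℤ.-1*i≡-i (∑ᶜ d g)) ⟩
    ∑ᶜ d f -ℤ ∑ᶜ d g                   ∎
    where open ≡-Reasoning

  ∑ᶜ-comm : ∀ d (f : Vec (Fin N) d → Fin N → ℤ) →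
    ∑ᶜ d (λ κ → ∑[ a < N ] f κ a) ≡ ∑[ a < N ] ∑ᶜ d (λ κ → f κ a)
  ∑ᶜ-comm zero    f = refl
  ∑ᶜ-comm (suc d) f =
    trans (sum-cong-≗ {N} (λ a → ∑ᶜ-comm d (f ∘ (a ∷_)))) (∑-comm (λ a b → ∑ᶜ d (λ κ → f (a ∷ κ) b)))

  ∑ᶜ-++ : ∀ d e (f : Vec (Fin N) (d + e) → ℤ) → ∑ᶜ (d + e) f ≡ ∑ᶜ d (λ κ → ∑ᶜ e (λ τ → f (κ ++ τ)))
  ∑ᶜ-++ zero    e f = refl
  ∑ᶜ-++ (suc d) e f = sum-cong-≗ {N} (λ a → ∑ᶜ-++ d e (f ∘ (a ∷_)))

  sumℤ-allColourings : ∀ d (f : Vec (Fin N) d → ℤ) → sumℤ (map f (allVecs (allFin N) d)) ≡ ∑ᶜ d f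
  sumℤ-allColourings zero    f = ℤ.+-identityʳ (f [])
  sumℤ-allColourings (suc d) f = trans (sumℤ-allVecs-suc (allFin N) d f)
    (trans (cong sumℤ (List.map-cong (λ a → sumℤ-allColourings d (f ∘ (a ∷_))) (allFin N)))
           (sumℤ-allFin N _))

𝟙 : Bool → ℤ
𝟙 b = if b then + 1 else + 0

if-as-𝟙 : ∀ b (w : ℤ) → (if b then w else + 0) ≡ 𝟙 b * w
if-as-𝟙 true  w = sym (ℤ.*-identityˡ w)
if-as-𝟙 false w = refl

𝟙-∧ : ∀ a b → 𝟙 (a ∧ b) ≡ 𝟙 a * 𝟙 b
𝟙-∧ true  b = sym (ℤ.*-identityˡ (𝟙 b))
𝟙-∧ false b = refl

𝟙-not-∧ : ∀ {A : Set} (d : Dec A) r → 𝟙 (not ⌊ d ⌋ ∧ r) ≡ 𝟙 r -ℤ 𝟙 (does d) * 𝟙 r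
𝟙-not-∧ (yes _) true  = refl
𝟙-not-∧ (yes _) false = refl
𝟙-not-∧ (no _)  true  = refl
𝟙-not-∧ (no _)  false = refl

T-⇔→≡ : ∀ {a b} → (T a ⇔ T b) → a ≡ b
T-⇔→≡ a⇔b = ⇔→≡ {z = true} (⇔-trans (⇔-sym T-≡) (⇔-trans a⇔b T-≡))

T-andFin : ∀ n {f : Fin n → Bool} → T (andFin n f) ⇔ (∀ i → T (f i))
T-andFin zero    = mk⇔ (λ _ ()) (λ _ → _)
T-andFin (suc n) = mk⇔
  (λ t → let (t₀ , t₊) = Equivalence.to T-∧ t in
         λ { zero → t₀ ; (suc i) → Equivalence.to (T-andFin n) t₊ i })
  (λ h → Equivalence.from T-∧ (h zero , Equivalence.from (T-andFin n) (h ∘ suc)))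

T-distinct : ∀ {N} (c d : Fin N) → T (not ⌊ c Fin.≟ d ⌋) ⇔ c ≢ d
T-distinct c d with c Fin.≟ d
... | yes c≡d = mk⇔ (λ ()) (λ c≢d → c≢d c≡d)
... | no  c≢d = mk⇔ (λ _ → c≢d) (λ _ → _)

T-separated : ∀ {N} a (c d : Fin N) → T (not a ∨ not ⌊ c Fin.≟ d ⌋) ⇔ (T a → c ≢ d)
T-separated false c d = mk⇔ (λ _ ()) (λ _ → _)
T-separated true  c d =
  mk⇔ (λ t _ → Equivalence.to (T-distinct c d) t) (λ h → Equivalence.from (T-distinct c d) (h _))

separated-transport : ∀ {N} {B B′ : Bool} {c d c′ d′ : Fin N} →
  B ≡ B′ → c ≡ c′ → d ≡ d′ → (T B′ → c′ ≢ d′) → T B → c ≢ d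
separated-transport B≡B′ c≡c′ d≡d′ sep t c≡d = sep (subst T B≡B′ t) (trans (sym c≡c′) (trans c≡d d≡d′))

graphOn : (n : ℕ) → (Fin n → Fin n → Bool) → Graph
graphOn n A = record { order = n ; adj = A }

Proper : (G : Graph) {N : ℕ} → (Fin (order G) → Fin N) → Set
Proper G κ = ∀ u w → T (adj G u w) → κ u ≢ κ w

T-proper : (G : Graph) {N : ℕ} (κ : Fin (order G) → Fin N) → T (proper G κ) ⇔ Proper G κ
T-proper G κ = mk⇔
  (λ t u w → Equivalence.to (T-separated (adj G u w) (κ u) (κ w))
               (Equivalence.to (T-andFin _) (Equivalence.to (T-andFin _) t u) w))
  (λ h → Equivalence.from (T-andFin _) λ u → Equivalence.from (T-andFin _) λ w →
           Equivalence.from (T-separated (adj G u w) (κ u) (κ w)) (h u w))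

isEdge : ∀ {n} → Fin n → Fin n → Fin n × Fin n → Bool
isEdge i j (a , b) = (⌊ a Fin.≟ i ⌋ ∧ ⌊ b Fin.≟ j ⌋) ∨ (⌊ a Fin.≟ j ⌋ ∧ ⌊ b Fin.≟ i ⌋)

fromEdges : ∀ {n} → List (Fin n × Fin n) → Fin n → Fin n → Bool
fromEdges E i j = any (isEdge i j) E

distinctEnds : ∀ {n N} → (Fin n → Fin N) → List (Fin n × Fin n) → Bool
distinctEnds κ = all (λ (a , b) → not ⌊ κ a Fin.≟ κ b ⌋)

T-isEdge : ∀ {n} {i j : Fin n} ab → T (isEdge i j ab) → (proj₁ ab ≡ i × proj₂ ab ≡ j) ⊎ (proj₁ ab ≡ j × proj₂ ab ≡ i)
T-isEdge (a , b) t = Sum.map both both (Equivalence.to T-∨ t)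
  where
  both : ∀ {a b i j} → T (⌊ a Fin.≟ i ⌋ ∧ ⌊ b Fin.≟ j ⌋) → a ≡ i × b ≡ j
  both {a} {b} {i} {j} t = let (t₁ , t₂) = Equivalence.to (T-∧ {⌊ a Fin.≟ i ⌋}) t
                           in toWitness {a? = a Fin.≟ i} t₁ , toWitness {a? = b Fin.≟ j} t₂

isEdge-self : ∀ {n} (a b : Fin n) → T (isEdge a b (a , b))
isEdge-self a b = Equivalence.from (T-∨ {⌊ a Fin.≟ a ⌋ ∧ ⌊ b Fin.≟ b ⌋})
  (inj₁ (Equivalence.from T-∧ (fromWitness {a? = a Fin.≟ a} refl , fromWitness {a? = b Fin.≟ b} refl)))

Proper-fromEdges : ∀ {n N} (E : List (Fin n × Fin n)) (κ : Fin n → Fin N) →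
  Proper (graphOn n (fromEdges E)) κ ⇔ T (distinctEnds κ E)
Proper-fromEdges []            κ = mk⇔ (λ _ → _) (λ _ _ _ ())
Proper-fromEdges ((a , b) ∷ E) κ = mk⇔
  (λ P → Equivalence.from T-∧
           ( Equivalence.from (T-distinct (κ a) (κ b)) (P a b (Equivalence.from T-∨ (inj₁ (isEdge-self a b))))
           , Equivalence.to IH (λ i j t → P i j (Equivalence.from T-∨ (inj₂ t)))))
  (λ t i j adj → let (ab , rest) = Equivalence.to T-∧ t in
     [ (λ hit → [ (λ { (refl , refl) → Equivalence.to (T-distinct (κ a) (κ b)) ab })
                , (λ { (refl , refl) → Equivalence.to (T-distinct (κ a) (κ b)) ab ∘ sym }) ]′
                (T-isEdge {i = i} {j = j} (a , b) hit))
     , Equivalence.from IH rest i j ]′ (Equivalence.to T-∨ adj))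
  where IH = Proper-fromEdges E κ

proper-fromEdges : ∀ {n N} (E : List (Fin n × Fin n)) (κ : Fin n → Fin N) →
  proper (graphOn n (fromEdges E)) κ ≡ distinctEnds κ E
proper-fromEdges E κ = T-⇔→≡ (⇔-trans (T-proper _ κ) (Proper-fromEdges E κ))

-- One-point unions

embedHead : ∀ p m → Fin (suc p) → Fin (p + suc m)
embedHead p m zero    = p ↑ʳ zero
embedHead p m (suc i) = i ↑ˡ suc m

data WedgeView (p m : ℕ) : Fin (p + suc m) → Set where
  inHead   : (i : Fin (suc p)) → WedgeView p m (embedHead p m i)
  pastRoot : (j : Fin m) → WedgeView p m (p ↑ʳ suc j)

wedgeView : ∀ p m (a : Fin (p + suc m)) → WedgeView p m a
wedgeView zero    m zero    = inHead zero
wedgeView zero    m (suc j) = pastRoot j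
wedgeView (suc p) m zero    = inHead (suc zero)
wedgeView (suc p) m (suc a) with wedgeView p m a
... | inHead zero    = inHead zero
... | inHead (suc i) = inHead (suc (suc i))
... | pastRoot j     = pastRoot j

-- A is the union of the head Aₕ and the tail Aₜ, glued at their vertices 0, which is vertex
-- p ↑ʳ zero of A; the head occupies the first p vertices of A.
record IsWedge {p m : ℕ} (A : Fin (p + suc m) → Fin (p + suc m) → Bool)
               (Aₕ : Fin (suc p) → Fin (suc p) → Bool) (Aₜ : Fin (suc m) → Fin (suc m) → Bool) : Set where
  field
    head-agrees     : ∀ i j → A (embedHead p m i) (embedHead p m j) ≡ Aₕ i j
    tail-agrees     : ∀ i j → A (p ↑ʳ i) (p ↑ʳ j) ≡ Aₜ i j
    head-tail-apart : ∀ i j → A (i ↑ˡ suc m) (p ↑ʳ suc j) ≡ false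
    tail-head-apart : ∀ i j → A (p ↑ʳ suc j) (i ↑ˡ suc m) ≡ false

module _ {p m : ℕ} {A : Fin (p + suc m) → Fin (p + suc m) → Bool}
         {Aₕ : Fin (suc p) → Fin (suc p) → Bool} {Aₜ : Fin (suc m) → Fin (suc m) → Bool}
         (W : IsWedge A Aₕ Aₜ) {N : ℕ} (u : Vec (Fin N) p) (c : Fin N) (w : Vec (Fin N) m) where

  open IsWedge W
  private
    κ  = lookup (u ++ c ∷ w)
    κₕ = lookup (c ∷ u)
    κₜ = lookup (c ∷ w)

    κ-head : ∀ i → κ (embedHead p m i) ≡ κₕ i
    κ-head zero    = lookup-++ʳ u (c ∷ w) zero
    κ-head (suc i) = lookup-++ˡ u (c ∷ w) i

    κ-tail : ∀ j → κ (p ↑ʳ j) ≡ κₜ j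
    κ-tail = lookup-++ʳ u (c ∷ w)

  Proper-wedge : Proper (graphOn (p + suc m) A) κ ⇔ (Proper (graphOn (suc p) Aₕ) κₕ × Proper (graphOn (suc m) Aₜ) κₜ)
  Proper-wedge = mk⇔
    (λ P → (λ i j → separated-transport (sym (head-agrees i j)) (sym (κ-head i)) (sym (κ-head j)) (P _ _))
         , (λ i j → separated-transport (sym (tail-agrees i j)) (sym (κ-tail i)) (sym (κ-tail j)) (P _ _)))
    (λ (Pₕ , Pₜ) a b → glue Pₕ Pₜ (wedgeView p m a) (wedgeView p m b))
    where
    glue : ∀ {a b} → Proper (graphOn (suc p) Aₕ) κₕ → Proper (graphOn (suc m) Aₜ) κₜ →
           WedgeView p m a → WedgeView p m b → T (A a b) → κ a ≢ κ b
    glue Pₕ Pₜ (inHead i) (inHead j) =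
      separated-transport (head-agrees i j) (κ-head i) (κ-head j) (Pₕ i j)
    glue Pₕ Pₜ (inHead zero) (pastRoot j) =
      separated-transport (tail-agrees zero (suc j)) (κ-tail zero) (κ-tail (suc j)) (Pₜ zero (suc j))
    glue Pₕ Pₜ (inHead (suc i)) (pastRoot j) t = ⊥-elim (subst T (head-tail-apart i j) t)
    glue Pₕ Pₜ (pastRoot j) (inHead zero) =
      separated-transport (tail-agrees (suc j) zero) (κ-tail (suc j)) (κ-tail zero) (Pₜ (suc j) zero)
    glue Pₕ Pₜ (pastRoot j) (inHead (suc i)) t = ⊥-elim (subst T (tail-head-apart i j) t)
    glue Pₕ Pₜ (pastRoot i) (pastRoot j) =
      separated-transport (tail-agrees (suc i) (suc j)) (κ-tail (suc i)) (κ-tail (suc j)) (Pₜ (suc i) (suc j))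

  proper-wedge : proper (graphOn (p + suc m) A) κ ≡ proper (graphOn (suc p) Aₕ) κₕ ∧ proper (graphOn (suc m) Aₜ) κₜ
  proper-wedge = T-⇔→≡ (⇔-trans (T-proper _ κ) (⇔-trans Proper-wedge
                   (⇔-sym (⇔-trans T-∧ (T-proper _ κₕ ×-⇔ T-proper _ κₜ)))))

module ColourSums (N : ℕ) (x : Fin N → ℤ) where

  open Colourings N public

  weight : ∀ {d} → Vec (Fin N) d → ℤ
  weight {d} κ = prodFin d (λ v → x (lookup κ v))

  weight-++ : ∀ {d e} (κ : Vec (Fin N) d) (τ : Vec (Fin N) e) → weight (κ ++ τ) ≡ weight κ * weight τ
  weight-++ []      τ = sym (ℤ.*-identityˡ (weight τ))
  weight-++ (a ∷ κ) τ = trans (cong (x a *_) (weight-++ κ τ)) (sym (ℤ.*-assoc (x a) _ _))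

  properWeight : (G : Graph) → Vec (Fin N) (order G) → ℤ
  properWeight G κ = if proper G (lookup κ) then weight κ else + 0

  rootedWeight : ∀ {p} → (Fin (suc p) → Fin (suc p) → Bool) → Fin N → Vec (Fin N) p → ℤ
  rootedWeight {p} A c κ = if proper (graphOn (suc p) A) (lookup (c ∷ κ)) then weight κ else + 0

  rooted : ∀ {p} → (Fin (suc p) → Fin (suc p) → Bool) → Fin N → ℤ
  rooted {p} A c = ∑ᶜ p (rootedWeight A c)

  module _ {p m : ℕ} {A : Fin (p + suc m) → Fin (p + suc m) → Bool}
           {Aₕ : Fin (suc p) → Fin (suc p) → Bool} {Aₜ : Fin (suc m) → Fin (suc m) → Bool}
           (W : IsWedge A Aₕ Aₜ) where

    properWeight-wedge : ∀ u c w →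
      properWeight (graphOn (p + suc m) A) (u ++ c ∷ w) ≡ rootedWeight Aₕ c u * (x c * rootedWeight Aₜ c w)
    properWeight-wedge u c w = begin
      (if proper G κ then weight (u ++ c ∷ w) else + 0)
        ≡⟨ if-as-𝟙 (proper G κ) _ ⟩
      𝟙 (proper G κ) * weight (u ++ c ∷ w)
        ≡⟨ cong₂ _*_ (trans (cong 𝟙 (proper-wedge W u c w)) (𝟙-∧ bₕ bₜ)) (weight-++ u (c ∷ w)) ⟩
      𝟙 bₕ * 𝟙 bₜ * (weight u * (x c * weight w))
        ≡⟨ solve 5 (λ a b P y Q → (a :* b) :* (P :* (y :* Q)) := (a :* P) :* (y :* (b :* Q))) refl
                 (𝟙 bₕ) (𝟙 bₜ) (weight u) (x c) (weight w) ⟩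
      𝟙 bₕ * weight u * (x c * (𝟙 bₜ * weight w))
        ≡⟨ cong₂ (λ h t → h * (x c * t)) (if-as-𝟙 bₕ _) (if-as-𝟙 bₜ _) ⟨
      rootedWeight Aₕ c u * (x c * rootedWeight Aₜ c w) ∎
      where
      open ≡-Reasoning
      G  = graphOn (p + suc m) A
      κ  = lookup (u ++ c ∷ w)
      bₕ = proper (graphOn (suc p) Aₕ) (lookup (c ∷ u))
      bₜ = proper (graphOn (suc m) Aₜ) (lookup (c ∷ w))

    X-wedge : X (graphOn (p + suc m) A) N x ≡ ∑[ c < N ] (rooted Aₕ c * (x c * rooted Aₜ c))
    X-wedge = begin
      X G N x
        ≡⟨ sumℤ-allColourings (p + suc m) (properWeight G) ⟩
      ∑ᶜ (p + suc m) (properWeight G)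
        ≡⟨ ∑ᶜ-++ p (suc m) _ ⟩
      ∑ᶜ p (λ u → ∑[ c < N ] ∑ᶜ m (λ w → properWeight G (u ++ c ∷ w)))
        ≡⟨ ∑ᶜ-cong p (λ u → sum-cong-≗ {N} (λ c → factor u c)) ⟩
      ∑ᶜ p (λ u → ∑[ c < N ] (rootedWeight Aₕ c u * (x c * rooted Aₜ c)))
        ≡⟨ ∑ᶜ-comm p _ ⟩
      ∑[ c < N ] ∑ᶜ p (λ u → rootedWeight Aₕ c u * (x c * rooted Aₜ c))
        ≡⟨ sum-cong-≗ {N} (λ c → *-distribʳ-∑ᶜ p _ (rootedWeight Aₕ c)) ⟨
      ∑[ c < N ] (rooted Aₕ c * (x c * rooted Aₜ c)) ∎
      where
      open ≡-Reasoning
      G = graphOn (p + suc m) A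
      factor : ∀ u c → ∑ᶜ m (λ w → properWeight G (u ++ c ∷ w)) ≡ rootedWeight Aₕ c u * (x c * rooted Aₜ c)
      factor u c = begin
        ∑ᶜ m (λ w → properWeight G (u ++ c ∷ w))
          ≡⟨ ∑ᶜ-cong m (properWeight-wedge u c) ⟩
        ∑ᶜ m (λ w → rootedWeight Aₕ c u * (x c * rootedWeight Aₜ c w))
          ≡⟨ *-distribˡ-∑ᶜ m (rootedWeight Aₕ c u) _ ⟨
        rootedWeight Aₕ c u * ∑ᶜ m (λ w → x c * rootedWeight Aₜ c w)
          ≡⟨ cong (rootedWeight Aₕ c u *_) (*-distribˡ-∑ᶜ m (x c) _) ⟨
        rootedWeight Aₕ c u * (x c * rooted Aₜ c) ∎

-- Power sums and elementary symmetric functions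

p : ℕ → (N : ℕ) → (Fin N → ℤ) → ℤ
p j N x = ∑[ a < N ] (x a ^ j)

module _ (N : ℕ) (x : Fin (suc N) → ℤ) where

  private
    subsets : List (Vec Bool N)
    subsets = allVecs (true ∷ false ∷ []) N

    summand : ∀ {n} → ℕ → (Fin n → ℤ) → Vec Bool n → ℤ
    summand {n} k y S = if count S ≡ᵇ k then prodFin n (λ i → if lookup S i then y i else + 1) else + 0

    summand-without-first : ∀ k S → summand k x (false ∷ S) ≡ summand k (x ∘ suc) S
    summand-without-first k S with count S ≡ᵇ k
    ... | true  = ℤ.*-identityˡ _
    ... | false = refl

    summand-with-first : ∀ k S → summand (suc k) x (true ∷ S) ≡ x zero * summand k (x ∘ suc) S
    summand-with-first k S with count S ≡ᵇ k
    ... | true  = refl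
    ... | false = sym (ℤ.*-zeroʳ (x zero))

    e-split : ∀ k → e k (suc N) x ≡ sumℤ (map (summand k x ∘ (true ∷_)) subsets) +ℤ e k N (x ∘ suc)
    e-split k = trans (sumℤ-allVecs-suc (true ∷ false ∷ []) N (summand k x))
      (cong (sumℤ (map (summand k x ∘ (true ∷_)) subsets) +ℤ_)
        (trans (ℤ.+-identityʳ _) (cong sumℤ (List.map-cong (summand-without-first k) subsets))))

  e-zero-suc : e 0 (suc N) x ≡ e 0 N (x ∘ suc)
  e-zero-suc = trans (e-split 0)
    (trans (cong (_+ℤ e 0 N (x ∘ suc)) (sumℤ-map-* (+ 0) (λ _ → + 0) subsets)) (ℤ.+-identityˡ _))

  e-suc : ∀ k → e (suc k) (suc N) x ≡ x zero * e k N (x ∘ suc) +ℤ e (suc k) N (x ∘ suc)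
  e-suc k = trans (e-split (suc k)) (cong (_+ℤ e (suc k) N (x ∘ suc))
    (trans (cong sumℤ (List.map-cong (summand-with-first k) subsets)) (sumℤ-map-* (x zero) _ subsets)))

e-zero : ∀ N (x : Fin N → ℤ) → e 0 N x ≡ + 1
e-zero zero    x = refl
e-zero (suc N) x = trans (e-zero-suc N x) (e-zero N (x ∘ suc))

eValues : (N : ℕ) → (Fin N → ℤ) → Vec ℤ 5
eValues N x = e 1 N x ∷ e 2 N x ∷ e 3 N x ∷ e 4 N x ∷ e 5 N x ∷ []

eValues-suc : ∀ N (x : Fin (suc N) → ℤ) → let x′ = x ∘ suc in
  eValues (suc N) x ≡ (x zero +ℤ e 1 N x′) ∷ (x zero * e 1 N x′ +ℤ e 2 N x′) ∷ (x zero * e 2 N x′ +ℤ e 3 N x′)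
                      ∷ (x zero * e 3 N x′ +ℤ e 4 N x′) ∷ (x zero * e 4 N x′ +ℤ e 5 N x′) ∷ []
eValues-suc N x = cong₂ _∷_ e₁-suc (cong₂ _∷_ (e-suc N x 1) (cong₂ _∷_ (e-suc N x 2)
                    (cong₂ _∷_ (e-suc N x 3) (cong₂ _∷_ (e-suc N x 4) refl))))
  where
  e₁-suc : e 1 (suc N) x ≡ x zero +ℤ e 1 N (x ∘ suc)
  e₁-suc = trans (e-suc N x 0)
    (cong (_+ℤ e 1 N (x ∘ suc)) (trans (cong (x zero *_) (e-zero N (x ∘ suc))) (ℤ.*-identityʳ (x zero))))

-- Girard–Waring: girard j expresses the power sum p_{j+1} through e₁, …, e₅.
girard : ∀ {n} → Fin 5 → (e₁ e₂ e₃ e₄ e₅ : Polynomial n) → Polynomial n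
girard 0F e₁ e₂ e₃ e₄ e₅ = e₁
girard 1F e₁ e₂ e₃ e₄ e₅ = e₁ :^ 2 :- con (+ 2) :* e₂
girard 2F e₁ e₂ e₃ e₄ e₅ = e₁ :^ 3 :- con (+ 3) :* e₁ :* e₂ :+ con (+ 3) :* e₃
girard 3F e₁ e₂ e₃ e₄ e₅ =
  e₁ :^ 4 :- con (+ 4) :* e₁ :^ 2 :* e₂ :+ con (+ 4) :* e₁ :* e₃ :+ con (+ 2) :* e₂ :^ 2 :- con (+ 4) :* e₄
girard 4F e₁ e₂ e₃ e₄ e₅ =
  e₁ :^ 5 :- con (+ 5) :* e₁ :^ 3 :* e₂ :+ con (+ 5) :* e₁ :^ 2 :* e₃ :+ con (+ 5) :* e₁ :* e₂ :^ 2
  :- con (+ 5) :* e₁ :* e₄ :- con (+ 5) :* e₂ :* e₃ :+ con (+ 5) :* e₅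

girardPolynomial : Fin 5 → Polynomial 5
girardPolynomial j = girard j (var 0F) (var 1F) (var 2F) (var 3F) (var 4F)

girard-vanishes : ∀ j → ⟦ girardPolynomial j ⟧ (eValues 0 (λ ())) ≡ + 0
girard-vanishes 0F = refl
girard-vanishes 1F = refl
girard-vanishes 2F = refl
girard-vanishes 3F = refl
girard-vanishes 4F = refl

-- Adding a variable y: p_{j+1} grows by y^{j+1}, and e_k becomes y e_{k-1} + e_k.
girard-step-equation : Fin 5 → N-ary 6 (Polynomial 6) (Polynomial 6 × Polynomial 6)
girard-step-equation j y a₁ a₂ a₃ a₄ a₅ =
  y :^ suc (toℕ j) :+ girard j a₁ a₂ a₃ a₄ a₅
  := girard j (y :+ a₁) (y :* a₁ :+ a₂) (y :* a₂ :+ a₃) (y :* a₃ :+ a₄) (y :* a₄ :+ a₅)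

girard-step : ∀ j y a₁ a₂ a₃ a₄ a₅ →
  y ^ suc (toℕ j) +ℤ ⟦ girardPolynomial j ⟧ (a₁ ∷ a₂ ∷ a₃ ∷ a₄ ∷ a₅ ∷ [])
  ≡ ⟦ girardPolynomial j ⟧ ((y +ℤ a₁) ∷ (y * a₁ +ℤ a₂) ∷ (y * a₂ +ℤ a₃) ∷ (y * a₃ +ℤ a₄) ∷ (y * a₄ +ℤ a₅) ∷ [])
girard-step 0F = solve 6 (girard-step-equation 0F) refl
girard-step 1F = solve 6 (girard-step-equation 1F) refl
girard-step 2F = solve 6 (girard-step-equation 2F) refl
girard-step 3F = solve 6 (girard-step-equation 3F) refl
girard-step 4F = solve 6 (girard-step-equation 4F) refl

p-girard : ∀ j N (x : Fin N → ℤ) → p (suc (toℕ j)) N x ≡ ⟦ girardPolynomial j ⟧ (eValues N x)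
p-girard j zero    x = sym (girard-vanishes j)
p-girard j (suc N) x = begin
  x zero ^ suc (toℕ j) +ℤ p (suc (toℕ j)) N (x ∘ suc)
    ≡⟨ cong (x zero ^ suc (toℕ j) +ℤ_) (p-girard j N (x ∘ suc)) ⟩
  x zero ^ suc (toℕ j) +ℤ ⟦ girardPolynomial j ⟧ (eValues N (x ∘ suc))
    ≡⟨ girard-step j (x zero) _ _ _ _ _ ⟩
  ⟦ girardPolynomial j ⟧ _
    ≡⟨ cong ⟦ girardPolynomial j ⟧ (eValues-suc N x) ⟨
  ⟦ girardPolynomial j ⟧ (eValues (suc N) x) ∎
  where open ≡-Reasoning

-- Rooted colour sums as polynomials

-- Using `does` rather than ⌊_⌋ lets δ (suc a) (suc b) reduce to δ a b, which ∑-δ relies on.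
δ : ∀ {n} → Fin n → Fin n → ℤ
δ a b = 𝟙 (does (a Fin.≟ b))

δ-refl : ∀ {n} (a : Fin n) → δ a a ≡ + 1
δ-refl a with a Fin.≟ a
... | yes _   = refl
... | no  a≢a = ⊥-elim (a≢a refl)

δ-idem : ∀ {n} (a b : Fin n) → δ a b ≡ δ a b * δ a b
δ-idem a b with a Fin.≟ b
... | yes _ = refl
... | no  _ = refl

δ-sym : ∀ {n} (a b : Fin n) → δ a b ≡ δ b a
δ-sym a b with a Fin.≟ b | b Fin.≟ a
... | yes _   | yes _   = refl
... | no  _   | no  _   = refl
... | yes a≡b | no  b≢a = ⊥-elim (b≢a (sym a≡b))
... | no  a≢b | yes b≡a = ⊥-elim (a≢b (sym b≡a))

δ-flip : ∀ {n} (a b : Fin n) → δ a b ≡ δ b a * δ a b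
δ-flip a b = trans (δ-idem a b) (cong (_* δ a b) (δ-sym a b))

∑-δ : ∀ {n} (b : Fin n) (f : Fin n → ℤ) → ∑[ a < n ] (δ a b * f a) ≡ f b
∑-δ {suc n} zero    f = trans (cong₂ _+ℤ_ (ℤ.*-identityˡ (f zero)) (sum-replicate-zero n)) (ℤ.+-identityʳ (f zero))
∑-δ {suc n} (suc b) f = trans (ℤ.+-identityˡ (∑[ a < n ] (δ a b * f (suc a)))) (∑-δ b (f ∘ suc))

Edge : ℕ → Set
Edge k = Fin (suc k) × Fin (suc k)

infixl 7 _⊗_
infixl 6 _⊖_

data Expr : Set where
  one      : Expr
  rootPow  : ℕ → Expr
  powerSum : ℕ → Expr
  _⊗_ _⊖_  : Expr → Expr → Expr

-- Merge vertex 1 into vertex t (numbered after the merge) and renumber the remaining vertices.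
contract : ∀ {k} → Fin (suc k) → Fin (suc (suc k)) → Fin (suc k)
contract t zero          = zero
contract t (suc zero)    = t
contract t (suc (suc i)) = suc i

contractEdge : ∀ {k} → Fin (suc k) → Edge (suc k) → Edge k
contractEdge t (a , b) = contract t a , contract t b

-- The vertex (numbered after the merge) that an equality constraint ties to vertex 1, if any.
linkOf : ∀ {k} → Edge (suc k) → Maybe (Fin (suc k))
linkOf (suc zero    , zero)        = just zero
linkOf (suc zero    , suc (suc j)) = just (suc j)
linkOf (zero        , suc zero)    = just zero
linkOf (suc (suc i) , suc zero)    = just (suc i)
linkOf _                           = nothing

partner : ∀ {k} → List (Edge (suc k)) → Maybe (Fin (suc k))
partner []         = nothing
partner (ab ∷ eqs) with linkOf ab
... | just t  = just t
... | nothing = partner eqs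

-- Summing out vertex 1, which carries exponent j: if no constraint ties it to another vertex it
-- contributes the power sum p_j, if it is tied to the root it contributes x_c^j, and if it is
-- tied to another vertex it hands its exponent over to that vertex.
mutual
  eliminate : (k : ℕ) → Vec ℕ k → List (Edge k) → Expr
  eliminate zero    []       eqs = one
  eliminate (suc k) (j ∷ js) eqs = eliminateFirst k j js eqs (partner eqs)

  eliminateFirst : ∀ k → ℕ → Vec ℕ k → List (Edge (suc k)) → Maybe (Fin (suc k)) → Expr
  eliminateFirst k j js eqs nothing        = powerSum j ⊗ eliminate k js (map (contractEdge zero) eqs)
  eliminateFirst k j js eqs (just zero)    = rootPow j ⊗ eliminate k js (map (contractEdge zero) eqs)
  eliminateFirst k j js eqs (just (suc i)) =
    eliminate k (updateAt js i (λ j′ → j + j′)) (map (contractEdge (suc i)) eqs)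

-- Inclusion–exclusion on a distinctness constraint: [a ≠ b] = 1 − [a = b].
expand : (k : ℕ) → Vec ℕ k → List (Edge k) → List (Edge k) → Expr
expand k js eqs []          = eliminate k js eqs
expand k js eqs (ab ∷ neqs) = expand k js eqs neqs ⊖ expand k js (ab ∷ eqs) neqs

headExpr : ∀ {k} → List (Edge k) → Expr
headExpr {k} E = expand k (replicate k 1) [] E

module Semantics (N : ℕ) (x : Fin N → ℤ) (c : Fin N) where

  open ColourSums N x

  colour : ∀ {k} → Vec (Fin N) k → Fin (suc k) → Fin N
  colour u = lookup (c ∷ u)

  ⟦_⟧ₑ : Expr → ℤ
  ⟦ one        ⟧ₑ = + 1
  ⟦ rootPow j  ⟧ₑ = x c ^ j
  ⟦ powerSum j ⟧ₑ = p j N x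
  ⟦ s ⊗ t      ⟧ₑ = ⟦ s ⟧ₑ * ⟦ t ⟧ₑ
  ⟦ s ⊖ t      ⟧ₑ = ⟦ s ⟧ₑ -ℤ ⟦ t ⟧ₑ

  sameColour : ∀ {k} → Vec (Fin N) k → Edge k → ℤ
  sameColour u (a , b) = δ (colour u a) (colour u b)

  agree : ∀ {k} → Vec (Fin N) k → List (Edge k) → ℤ
  agree u []         = + 1
  agree u (ab ∷ eqs) = sameColour u ab * agree u eqs

  monomial : ∀ {k} → Vec ℕ k → Vec (Fin N) k → ℤ
  monomial []       []      = + 1
  monomial (j ∷ js) (a ∷ u) = x a ^ j * monomial js u

  agree-contract : ∀ {k} (t : Fin (suc k)) u (eqs : List (Edge (suc k))) →
    agree (colour u t ∷ u) eqs ≡ agree u (map (contractEdge t) eqs)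
  agree-contract t u []              = refl
  agree-contract t u ((a , b) ∷ eqs) =
    cong₂ _*_ (cong₂ δ (colour-contract a) (colour-contract b)) (agree-contract t u eqs)
    where
    colour-contract : ∀ i → colour (colour u t ∷ u) i ≡ colour u (contract t i)
    colour-contract zero          = refl
    colour-contract (suc zero)    = refl
    colour-contract (suc (suc i)) = refl

  agree-root : (eqs : List (Edge 0)) → agree [] eqs ≡ + 1
  agree-root []                    = refl
  agree-root ((zero , zero) ∷ eqs) = cong₂ _*_ (δ-refl c) (agree-root eqs)

  monomial-updateAt : ∀ {k} (i : Fin k) j (js : Vec ℕ k) u →
    x (lookup u i) ^ j * monomial js u ≡ monomial (updateAt js i (λ j′ → j + j′)) u
  monomial-updateAt zero    j (j′ ∷ js) (a ∷ u) =
    trans (sym (ℤ.*-assoc (x a ^ j) _ _)) (cong (_* monomial js u) (sym (ℤ.^-distribˡ-+-* (x a) j j′)))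
  monomial-updateAt (suc i) j (j′ ∷ js) (a ∷ u) =
    trans (x∙yz≈y∙xz (x (lookup u i) ^ j) (x a ^ j′) (monomial js u))
          (cong (x a ^ j′ *_) (monomial-updateAt i j js u))

  data Link {k} (ab : Edge (suc k)) : Maybe (Fin (suc k)) → Set where
    linked : ∀ t → (∀ a u → sameColour (a ∷ u) ab ≡ δ a (colour u t) * sameColour (a ∷ u) ab) → Link ab (just t)
    free   : (∀ a u → sameColour (a ∷ u) ab ≡ sameColour u (contractEdge zero ab)) → Link ab nothing

  linkSpec : ∀ {k} (ab : Edge (suc k)) → Link ab (linkOf ab)
  linkSpec (suc zero    , zero)        = linked zero (λ a u → δ-idem a c)
  linkSpec (suc zero    , suc (suc j)) = linked (suc j) (λ a u → δ-idem a (lookup u j))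
  linkSpec (zero        , suc zero)    = linked zero (λ a u → δ-flip c a)
  linkSpec (suc (suc i) , suc zero)    = linked (suc i) (λ a u → δ-flip (lookup u i) a)
  linkSpec (zero        , zero)        = free (λ a u → refl)
  linkSpec (zero        , suc (suc j)) = free (λ a u → refl)
  linkSpec (suc zero    , suc zero)    = free (λ a u → trans (δ-refl a) (sym (δ-refl c)))
  linkSpec (suc (suc i) , zero)        = free (λ a u → refl)
  linkSpec (suc (suc i) , suc (suc j)) = free (λ a u → refl)

  data Partner {k} (eqs : List (Edge (suc k))) : Maybe (Fin (suc k)) → Set where
    linked : ∀ t → (∀ a u → agree (a ∷ u) eqs ≡ δ a (colour u t) * agree (a ∷ u) eqs) → Partner eqs (just t)
    free   : (∀ a u → agree (a ∷ u) eqs ≡ agree u (map (contractEdge zero) eqs)) → Partner eqs nothing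

  partnerSpec : ∀ {k} (eqs : List (Edge (suc k))) → Partner eqs (partner eqs)
  partnerSpec []         = free (λ a u → refl)
  partnerSpec (ab ∷ eqs) with linkOf ab | linkSpec ab
  ... | just t  | linked .t h = linked t (λ a u →
        trans (cong (_* agree (a ∷ u) eqs) (h a u))
              (ℤ.*-assoc (δ a (colour u t)) (sameColour (a ∷ u) ab) (agree (a ∷ u) eqs)))
  ... | nothing | free h with partner eqs | partnerSpec eqs
  ...   | just t  | linked .t h′ = linked t (λ a u →
          trans (cong (sameColour (a ∷ u) ab *_) (h′ a u))
                (x∙yz≈y∙xz (sameColour (a ∷ u) ab) (δ a (colour u t)) (agree (a ∷ u) eqs)))
  ...   | nothing | free h′ = free (λ a u → cong₂ _*_ (h a u) (h′ a u))

  linked-sum : ∀ {k} (eqs : List (Edge (suc k))) t →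
    (∀ a u → agree (a ∷ u) eqs ≡ δ a (colour u t) * agree (a ∷ u) eqs) → ∀ j u M →
    ∑[ a < N ] (agree (a ∷ u) eqs * (x a ^ j * M)) ≡ agree u (map (contractEdge t) eqs) * (x (colour u t) ^ j * M)
  linked-sum eqs t h j u M = begin
    ∑[ a < N ] (agree (a ∷ u) eqs * (x a ^ j * M))
      ≡⟨ sum-cong-≗ {N} (λ a → trans (cong (_* (x a ^ j * M)) (h a u)) (ℤ.*-assoc (δ a v) _ _)) ⟩
    ∑[ a < N ] (δ a v * (agree (a ∷ u) eqs * (x a ^ j * M)))
      ≡⟨ ∑-δ v (λ a → agree (a ∷ u) eqs * (x a ^ j * M)) ⟩
    agree (v ∷ u) eqs * (x v ^ j * M)
      ≡⟨ cong (_* (x v ^ j * M)) (agree-contract t u eqs) ⟩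
    agree u (map (contractEdge t) eqs) * (x v ^ j * M) ∎
    where
    open ≡-Reasoning
    v = colour u t

  mutual
    eliminate-sound : ∀ k js (eqs : List (Edge k)) →
      ∑ᶜ k (λ u → agree u eqs * monomial js u) ≡ ⟦ eliminate k js eqs ⟧ₑ
    eliminate-sound zero    []       eqs = trans (ℤ.*-identityʳ _) (agree-root eqs)
    eliminate-sound (suc k) (j ∷ js) eqs =
      trans (sym (∑ᶜ-comm k (λ u a → agree (a ∷ u) eqs * (x a ^ j * monomial js u))))
            (eliminateFirst-sound k j js eqs (partnerSpec eqs))

    eliminateFirst-sound : ∀ k j js (eqs : List (Edge (suc k))) {t} → Partner eqs t →
      ∑ᶜ k (λ u → ∑[ a < N ] (agree (a ∷ u) eqs * (x a ^ j * monomial js u))) ≡ ⟦ eliminateFirst k j js eqs t ⟧ₑ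
    eliminateFirst-sound k j js eqs (free h) = begin
      ∑ᶜ k (λ u → ∑[ a < N ] (agree (a ∷ u) eqs * (x a ^ j * monomial js u)))
        ≡⟨ ∑ᶜ-cong k (λ u → sum-cong-≗ {N} (λ a →
             trans (cong (_* _) (h a u)) (x∙yz≈y∙xz (agree u eqs′) (x a ^ j) (monomial js u)))) ⟩
      ∑ᶜ k (λ u → ∑[ a < N ] (x a ^ j * (agree u eqs′ * monomial js u)))
        ≡⟨ ∑ᶜ-cong k (λ u → *-distribʳ-sum {N} _ (λ a → x a ^ j)) ⟨
      ∑ᶜ k (λ u → p j N x * (agree u eqs′ * monomial js u))
        ≡⟨ *-distribˡ-∑ᶜ k (p j N x) _ ⟨
      p j N x * ∑ᶜ k (λ u → agree u eqs′ * monomial js u)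
        ≡⟨ cong (p j N x *_) (eliminate-sound k js eqs′) ⟩
      p j N x * ⟦ eliminate k js eqs′ ⟧ₑ ∎
      where
      open ≡-Reasoning
      eqs′ = map (contractEdge zero) eqs
    eliminateFirst-sound k j js eqs (linked zero h) = begin
      ∑ᶜ k (λ u → ∑[ a < N ] (agree (a ∷ u) eqs * (x a ^ j * monomial js u)))
        ≡⟨ ∑ᶜ-cong k (λ u → trans (linked-sum eqs zero h j u (monomial js u))
             (x∙yz≈y∙xz (agree u eqs′) (x c ^ j) (monomial js u))) ⟩
      ∑ᶜ k (λ u → x c ^ j * (agree u eqs′ * monomial js u))
        ≡⟨ *-distribˡ-∑ᶜ k (x c ^ j) _ ⟨
      x c ^ j * ∑ᶜ k (λ u → agree u eqs′ * monomial js u)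
        ≡⟨ cong (x c ^ j *_) (eliminate-sound k js eqs′) ⟩
      x c ^ j * ⟦ eliminate k js eqs′ ⟧ₑ ∎
      where
      open ≡-Reasoning
      eqs′ = map (contractEdge zero) eqs
    eliminateFirst-sound k j js eqs (linked (suc i) h) = begin
      ∑ᶜ k (λ u → ∑[ a < N ] (agree (a ∷ u) eqs * (x a ^ j * monomial js u)))
        ≡⟨ ∑ᶜ-cong k (λ u → trans (linked-sum eqs (suc i) h j u (monomial js u))
             (cong (agree u eqs′ *_) (monomial-updateAt i j js u))) ⟩
      ∑ᶜ k (λ u → agree u eqs′ * monomial js′ u)
        ≡⟨ eliminate-sound k js′ eqs′ ⟩
      ⟦ eliminate k js′ eqs′ ⟧ₑ ∎
      where
      open ≡-Reasoning
      eqs′ = map (contractEdge (suc i)) eqs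
      js′  = updateAt js i (λ j′ → j + j′)

  expand-sound : ∀ k js (eqs neqs : List (Edge k)) →
    ∑ᶜ k (λ u → agree u eqs * (𝟙 (distinctEnds (colour u) neqs) * monomial js u)) ≡ ⟦ expand k js eqs neqs ⟧ₑ
  expand-sound k js eqs [] =
    trans (∑ᶜ-cong k (λ u → cong (agree u eqs *_) (ℤ.*-identityˡ (monomial js u)))) (eliminate-sound k js eqs)
  expand-sound k js eqs ((a , b) ∷ neqs) = begin
    ∑ᶜ k (λ u → agree u eqs * (𝟙 (not ⌊ colour u a Fin.≟ colour u b ⌋ ∧ r u) * monomial js u))
      ≡⟨ ∑ᶜ-cong k (λ u → trans
           (cong (λ z → agree u eqs * (z * monomial js u)) (𝟙-not-∧ (colour u a Fin.≟ colour u b) (r u)))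
           (solve 4 (λ A D R M → A :* ((R :- D :* R) :* M) := A :* (R :* M) :- D :* A :* (R :* M)) refl
                  (agree u eqs) (sameColour u (a , b)) (𝟙 (r u)) (monomial js u))) ⟩
    ∑ᶜ k (λ u → agree u eqs * (𝟙 (r u) * monomial js u) -ℤ agree u ((a , b) ∷ eqs) * (𝟙 (r u) * monomial js u))
      ≡⟨ ∑ᶜ-distrib-− k _ _ ⟩
    ∑ᶜ k (λ u → agree u eqs * (𝟙 (r u) * monomial js u))
      -ℤ ∑ᶜ k (λ u → agree u ((a , b) ∷ eqs) * (𝟙 (r u) * monomial js u))
      ≡⟨ cong₂ _-ℤ_ (expand-sound k js eqs neqs) (expand-sound k js ((a , b) ∷ eqs) neqs) ⟩
    ⟦ expand k js eqs neqs ⟧ₑ -ℤ ⟦ expand k js ((a , b) ∷ eqs) neqs ⟧ₑ ∎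
    where
    open ≡-Reasoning
    r : Vec (Fin N) k → Bool
    r u = distinctEnds (colour u) neqs

  weight-monomial : ∀ {k} (u : Vec (Fin N) k) → weight u ≡ monomial (replicate k 1) u
  weight-monomial []      = refl
  weight-monomial (a ∷ u) = cong₂ _*_ (sym (ℤ.*-identityʳ (x a))) (weight-monomial u)

  rooted-headExpr : ∀ {k} (E : List (Edge k)) → rooted (fromEdges E) c ≡ ⟦ headExpr E ⟧ₑ
  rooted-headExpr {k} E = trans (∑ᶜ-cong k summand) (expand-sound k (replicate k 1) [] E)
    where
    summand : ∀ u → rootedWeight (fromEdges E) c u ≡ + 1 * (𝟙 (distinctEnds (colour u) E) * monomial (replicate k 1) u)
    summand u = trans (if-as-𝟙 _ (weight u))
      (trans (cong₂ _*_ (cong 𝟙 (proper-fromEdges E (colour u))) (weight-monomial u)) (sym (ℤ.*-identityˡ _)))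

  env : Vec ℤ 6
  env = x c ∷ eValues N x

  -- p₁, …, p₅ become polynomials in e₁, …, e₅; any other power sum (never produced for our
  -- heads) is kept as a constant, so that the translation is sound for every expression.
  powerSumPolynomial : ℕ → Polynomial 6
  powerSumPolynomial 1 = girard 0F (var 1F) (var 2F) (var 3F) (var 4F) (var 5F)
  powerSumPolynomial 2 = girard 1F (var 1F) (var 2F) (var 3F) (var 4F) (var 5F)
  powerSumPolynomial 3 = girard 2F (var 1F) (var 2F) (var 3F) (var 4F) (var 5F)
  powerSumPolynomial 4 = girard 3F (var 1F) (var 2F) (var 3F) (var 4F) (var 5F)
  powerSumPolynomial 5 = girard 4F (var 1F) (var 2F) (var 3F) (var 4F) (var 5F)
  powerSumPolynomial j = con (p j N x)

  toPolynomial : Expr → Polynomial 6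
  toPolynomial one          = con (+ 1)
  toPolynomial (rootPow j)  = var 0F :^ j
  toPolynomial (powerSum j) = powerSumPolynomial j
  toPolynomial (s ⊗ t)      = toPolynomial s :* toPolynomial t
  toPolynomial (s ⊖ t)      = toPolynomial s :- toPolynomial t

  toPolynomial-sound : ∀ s → ⟦ toPolynomial s ⟧ env ≡ ⟦ s ⟧ₑ
  toPolynomial-sound one          = refl
  toPolynomial-sound (rootPow j)  = ^-sound j
    where
    ^-sound : ∀ j → ⟦ var 0F :^ j ⟧ env ≡ x c ^ j
    ^-sound zero    = refl
    ^-sound (suc j) = cong (x c *_) (^-sound j)
  toPolynomial-sound (powerSum 0) = refl
  toPolynomial-sound (powerSum 1) = sym (p-girard 0F N x)
  toPolynomial-sound (powerSum 2) = sym (p-girard 1F N x)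
  toPolynomial-sound (powerSum 3) = sym (p-girard 2F N x)
  toPolynomial-sound (powerSum 4) = sym (p-girard 3F N x)
  toPolynomial-sound (powerSum 5) = sym (p-girard 4F N x)
  toPolynomial-sound (powerSum (suc (suc (suc (suc (suc (suc j))))))) = refl
  toPolynomial-sound (s ⊗ t) = cong₂ _*_ (toPolynomial-sound s) (toPolynomial-sound t)
  toPolynomial-sound (s ⊖ t) = cong₂ _-ℤ_ (toPolynomial-sound s) (toPolynomial-sound t)

  rooted-as-polynomial : ∀ {k} (E : List (Edge k)) → rooted (fromEdges E) c ≡ ⟦ toPolynomial (headExpr E) ⟧ env
  rooted-as-polynomial E = trans (rooted-headExpr E) (sym (toPolynomial-sound (headExpr E)))

-- The twin tadpole and the paths as one-point unions

-- Agreement on the finitely many vertices of a head is decided by evaluation, even when the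
-- length m of the tail is a variable.
agrees? : ∀ {n n′} (f : Fin n → Fin n′) (A : Fin n′ → Fin n′ → Bool) (B : Fin n → Fin n → Bool) →
  Dec (∀ i j → A (f i) (f j) ≡ B i j)
agrees? f A B = all? λ i → all? λ j → A (f i) (f j) Bool.≟ B i j

pathHeadEdges : (q : ℕ) → List (Edge q)
pathHeadEdges q = List.zip vertices (List.drop 1 vertices)
  where
  vertices : List (Fin (suc q))
  vertices = map suc (allFin q) List.++ zero ∷ []

path-symmetric : ∀ n (u w : Fin n) → adj (path n) u w ≡ adj (path n) w u
path-symmetric n u w = ∨-comm (suc (toℕ u) ≡ᵇ toℕ w) (suc (toℕ w) ≡ᵇ toℕ u)

path-tail : ∀ q m (i j : Fin (suc m)) → adj (path (q + suc m)) (q ↑ʳ i) (q ↑ʳ j) ≡ adj (path (suc m)) i j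
path-tail zero    m i j = refl
path-tail (suc q) m i j = path-tail q m i j

path-head-tail-apart : ∀ q m (i : Fin q) (j : Fin m) → adj (path (q + suc m)) (i ↑ˡ suc m) (q ↑ʳ suc j) ≡ false
path-head-tail-apart (suc zero)    m zero    j = refl
path-head-tail-apart (suc (suc q)) m zero    j = refl
path-head-tail-apart (suc q)       m (suc i) j = path-head-tail-apart q m i j

path-wedge : ∀ q m →
  (∀ i j → adj (path (q + suc m)) (embedHead q m i) (embedHead q m j) ≡ fromEdges (pathHeadEdges q) i j) →
  IsWedge (adj (path (q + suc m))) (fromEdges (pathHeadEdges q)) (adj (path (suc m)))
path-wedge q m head = record
  { head-agrees     = head
  ; tail-agrees     = path-tail q m
  ; head-tail-apart = path-head-tail-apart q m
  ; tail-head-apart = λ i j → trans (path-symmetric _ (q ↑ʳ suc j) (i ↑ˡ suc m)) (path-head-tail-apart q m i j)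
  }

pathHeads-agree : ∀ m (q : Fin 6) i j →
  adj (path (toℕ q + suc m)) (embedHead (toℕ q) m i) (embedHead (toℕ q) m j) ≡ fromEdges (pathHeadEdges (toℕ q)) i j
pathHeads-agree m = toWitness {a? = all? λ q →
  agrees? (embedHead (toℕ q) m) (adj (path (toℕ q + suc m))) (fromEdges (pathHeadEdges (toℕ q)))} _

tadpoleTwin : ℕ → Graph
tadpoleTwin b = twin (tadpole 4 b) (v₄ b)

-- Head vertices: 0 = v₅ (the root), 1 = v₄′, and 2, 3, 4, 5 = v₁, v₂, v₃, v₄.
twinHeadEdges : List (Edge 5)
twinHeadEdges = (# 0 , # 1) ∷ (# 0 , # 5) ∷ (# 1 , # 2) ∷ (# 1 , # 4) ∷ (# 1 , # 5)
              ∷ (# 2 , # 3) ∷ (# 3 , # 4) ∷ (# 4 , # 5) ∷ (# 2 , # 5) ∷ []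

toℕ<ᵇ : ∀ {n} (i : Fin n) → (toℕ i <ᵇ n) ≡ true
toℕ<ᵇ i = Equivalence.to T-≡ (ℕ.<⇒<ᵇ (toℕ<n i))

tadpoleTwin-tail : ∀ m (i j : Fin (suc m)) → adj (tadpoleTwin (suc m)) (5 ↑ʳ i) (5 ↑ʳ j) ≡ adj (path (suc m)) i j
tadpoleTwin-tail m i j =
  cong₂ (λ a b → (a ∧ (suc (toℕ i) ≡ᵇ toℕ j)) ∨ (b ∧ (suc (toℕ j) ≡ᵇ toℕ i))) (toℕ<ᵇ j) (toℕ<ᵇ i)

tadpoleTwin-wedge : ∀ m → IsWedge (adj (tadpoleTwin (suc m))) (fromEdges twinHeadEdges) (adj (path (suc m)))
tadpoleTwin-wedge m = record
  { head-agrees     = toWitness {a? = agrees? (embedHead 5 m) A (fromEdges twinHeadEdges)} _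
  ; tail-agrees     = tadpoleTwin-tail m
  ; head-tail-apart = λ i j → toWitness {a? = all? λ (i : Fin 5) → A (i ↑ˡ suc m) (5 ↑ʳ suc j) Bool.≟ false} _ i
  ; tail-head-apart = λ i j → toWitness {a? = all? λ (i : Fin 5) → A (5 ↑ʳ suc j) (i ↑ˡ suc m) Bool.≟ false} _ i
  }
  where
  A = adj (tadpoleTwin (suc m))

-- The coefficient of X_{P_{b+q}} in the claim, as a polynomial in e₁, …, e₅.
coefficient : ∀ {n} → Fin 6 → (e₁ e₂ e₃ e₄ e₅ : Polynomial n) → Polynomial n
coefficient 5F e₁ e₂ e₃ e₄ e₅ = con (+ 20)
coefficient 4F e₁ e₂ e₃ e₄ e₅ = con (+ 2) :* e₁
coefficient 3F e₁ e₂ e₃ e₄ e₅ = con (- (+ 16)) :* e₂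
coefficient 2F e₁ e₂ e₃ e₄ e₅ = :- (con (+ 2) :* (e₂ :* e₁) :+ con (+ 42) :* e₃)
coefficient 1F e₁ e₂ e₃ e₄ e₅ = :- (con (+ 56) :* e₄ :+ con (+ 4) :* (e₂ :* e₂) :+ con (+ 4) :* (e₃ :* e₁))
coefficient 0F e₁ e₂ e₃ e₄ e₅ = :- (con (+ 6) :* (e₄ :* e₁) :+ con (+ 4) :* (e₃ :* e₂) :+ con (+ 50) :* e₅)

∑ₚ : ∀ {n k} → (Fin k → Polynomial n) → Polynomial n
∑ₚ {k = zero}  f = con (+ 0)
∑ₚ {k = suc k} f = f zero :+ ∑ₚ (f ∘ suc)

module _ (N : ℕ) (x : Fin N → ℤ) where

  open ColourSums N x

  coeff : Fin 6 → ℤ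
  coeff q = ⟦ coefficient q (var 0F) (var 1F) (var 2F) (var 3F) (var 4F) ⟧ (eValues N x)

  twinHead-as-pathHeads : ∀ c →
    rooted (fromEdges twinHeadEdges) c ≡ ∑[ q < 6 ] (coeff q * rooted (fromEdges (pathHeadEdges (toℕ q))) c)
  twinHead-as-pathHeads c = begin
    rooted (fromEdges twinHeadEdges) c
      ≡⟨ rooted-as-polynomial twinHeadEdges ⟩
    ⟦ toPolynomial (headExpr twinHeadEdges) ⟧ env
      ≡⟨ prove env (toPolynomial (headExpr twinHeadEdges)) pathHeadCombination refl ⟩
    ⟦ pathHeadCombination ⟧ env
      ≡⟨ sum-cong-≗ {6} (λ q → cong (coeff q *_) (rooted-as-polynomial (pathHeadEdges (toℕ q)))) ⟨
    ∑[ q < 6 ] (coeff q * rooted (fromEdges (pathHeadEdges (toℕ q))) c) ∎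
    where
    open ≡-Reasoning
    open Semantics N x c
    pathHeadCombination : Polynomial 6
    pathHeadCombination = ∑ₚ (λ q → coefficient q (var 1F) (var 2F) (var 3F) (var 4F) (var 5F)
                                    :* toPolynomial (headExpr (pathHeadEdges (toℕ q))))

  X-path-wedge : ∀ m (q : Fin 6) → X (path (suc m + toℕ q)) N x
    ≡ ∑[ c < N ] (rooted (fromEdges (pathHeadEdges (toℕ q))) c * (x c * rooted (adj (path (suc m))) c))
  X-path-wedge m q = trans (cong (λ n → X (path n) N x) (ℕ.+-comm (suc m) (toℕ q)))
                           (X-wedge (path-wedge (toℕ q) m (pathHeads-agree m q)))

∑₆-reversed : ∀ b (k : Fin 6 → ℤ) (h : ℕ → ℤ) → ∑[ q < 6 ] (k q * h (b + toℕ q))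
  ≡ k 5F * h (b + 5) +ℤ k 4F * h (b + 4) +ℤ k 3F * h (b + 3) +ℤ k 2F * h (b + 2) +ℤ k 1F * h (b + 1) +ℤ k 0F * h b
∑₆-reversed b k h rewrite ℕ.+-identityʳ b =
  solve 6 (λ a₀ a₁ a₂ a₃ a₄ a₅ → a₀ :+ (a₁ :+ (a₂ :+ (a₃ :+ (a₄ :+ (a₅ :+ con (+ 0))))))
                                 := a₅ :+ a₄ :+ a₃ :+ a₂ :+ a₁ :+ a₀)
          refl (k 0F * h b) (k 1F * h (b + 1)) (k 2F * h (b + 2)) (k 3F * h (b + 3)) (k 4F * h (b + 4)) (k 5F * h (b + 5))

proposition3p4 : (b : ℕ) → 1 ≤ b → (N : ℕ) → (x : Fin N → ℤ) →
    X (twin (tadpole 4 b) (v₄ b)) N x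
    ≡ (+ 20) * X (path (b + 5)) N x
      +ℤ (+ 2) * e 1 N x * X (path (b + 4)) N x
      +ℤ (- (+ 16)) * e 2 N x * X (path (b + 3)) N x
      +ℤ (- ((+ 2) * (e 2 N x * e 1 N x) +ℤ (+ 42) * e 3 N x)) * X (path (b + 2)) N x
      +ℤ (- ((+ 56) * e 4 N x +ℤ (+ 4) * (e 2 N x * e 2 N x) +ℤ (+ 4) * (e 3 N x * e 1 N x))) * X (path (b + 1)) N x
      +ℤ (- ((+ 6) * (e 4 N x * e 1 N x) +ℤ (+ 4) * (e 3 N x * e 2 N x) +ℤ (+ 50) * e 5 N x)) * X (path b) N x
proposition3p4 (suc m) _ N x = begin
  X (tadpoleTwin (suc m)) N x
    ≡⟨ X-wedge (tadpoleTwin-wedge m) ⟩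
  ∑[ c < N ] (rooted (fromEdges twinHeadEdges) c * tail c)
    ≡⟨ sum-cong-≗ {N} (λ c → cong (_* tail c) (twinHead-as-pathHeads N x c)) ⟩
  ∑[ c < N ] (∑[ q < 6 ] (coeff N x q * rooted (pathHead q) c) * tail c)
    ≡⟨ ∑-linear (coeff N x) (λ q → rooted (pathHead q)) tail ⟩
  ∑[ q < 6 ] (coeff N x q * ∑[ c < N ] (rooted (pathHead q) c * tail c))
    ≡⟨ sum-cong-≗ {6} (λ q → cong (coeff N x q *_) (X-path-wedge N x m q)) ⟨
  ∑[ q < 6 ] (coeff N x q * X (path (suc m + toℕ q)) N x)
    ≡⟨ ∑₆-reversed (suc m) (coeff N x) (λ n → X (path n) N x) ⟩
  _ ∎
  where
  open ≡-Reasoning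
  open ColourSums N x
  pathHead : (q : Fin 6) → Fin (suc (toℕ q)) → Fin (suc (toℕ q)) → Bool
  pathHead q = fromEdges (pathHeadEdges (toℕ q))
  tail : Fin N → ℤ
  tail c = x c * rooted (adj (path (suc m))) c
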